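{- For any set of analytic rules $\mathcal{R}$, the system $\mathsf{ACT}_\omega+\mathcal{R}$ is complete with respect to the class of $*$-continuous action lattices axiomatized by $Q_a(\mathcal{R})$: for each sequent $S=(\alpha_0,\dots,\alpha_n\Rightarrow\beta)$, if every $*$-continuous action lattice satisfying $Q_a(\mathcal{R})$ satisfies $\alpha_0\cdots\alpha_n\leq\beta$, then $\mathsf{ACT}_\omega+\mathcal{R}\vdash S$.
   Context: Formulas are terms over $\{\wedge,\vee,\cdot,\backslash,/,{}^*,0,1\}$. A $*$-continuous action lattice is a residuated lattice with least element $0$ and a Kleene star ($1\vee xx^*\le x^*$, $xy\le y\Rightarrow x^*y\le y$, $yx\le y\Rightarrow yx^*\le y$) such that $a^*=\bigvee_n a^n$. An analytic rule has premises $\Gamma,\Upsilon_i,\Delta\Rightarrow\beta$ ($i<n$) and conclusion $\Gamma,\Upsilon,\Delta\Rightarrow\beta$, with $\Upsilon$ a sequence of distinct sequence metavariables (distinct from $\Gamma,\Delta$) and each $\Upsilon_i$ a sequence of metavariables from $\Upsilon$. $Q_a(\mathcal{R})$ consists, for each such rule, of the quasiequation $t(\Upsilon_0)\le y\,\&\dots\&\,t(\Upsilon_{n-1})\le y\implies t(\Upsilon)\le y$, where $t$ replaces metavariables by distinct variables and commas by products (empty product $=1$). $\mathsf{ACT}_\omega+\mathcal{R}$ is the wellfounded cut-free sequent system with the identity axiom on variables, the rules in $\mathcal{R}$, standard left/right rules for $0,1,\wedge,\vee,\cdot,\backslash,/$, the right star rules ($\Rightarrow\beta^*$; from $\Gamma\Rightarrow\beta$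 and $\Delta\Rightarrow\beta^*$ infer $\Gamma,\Delta\Rightarrow\beta^*$) and the $\omega$-rule (from $\Gamma,\alpha^{(n)},\Delta\Rightarrow\beta$ for all $n\in\mathbb{N}$ infer $\Gamma,\alpha^*,\Delta\Rightarrow\beta$). -}

module Defs where

open import Level using (Level; _⊔_) renaming (suc to lsuc)
open import Data.Nat using (ℕ; zero; suc)
open import Data.Fin using (Fin)
open import Data.List using (List; []; _∷_; _++_; map; concatMap; replicate; length)
open import Data.List.Relation.Unary.All using (All)
open import Data.List using () renaming (allFin to allFinL)
open import Relation.Binary.Structures using (IsPartialOrder)

infixr 30 _·_
infixr 25 _∧_
infixr 20 _∨_

data Formula : Set where
  var  : ℕ → Formula
  _∧_  : Formula → Formula → Formula
  _∨_  : Formula → Formula → Formula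
  _·_  : Formula → Formula → Formula
  _⧵_  : Formula → Formula → Formula
  _/_  : Formula → Formula → Formula
  _⋆   : Formula → Formula
  𝟘    : Formula
  𝟙    : Formula

infix 5 _⇒_
record Sequent : Set where
  constructor _⇒_
  field
    ants : List Formula
    succ : Formula

-- Analytic rules.
-- Υ is a sequence of `arity` distinct metavariables; w.l.o.g. (up to
-- renaming) these are the elements of Fin arity in increasing order.
-- Each premise Υᵢ is a (finite) sequence of metavariables from Υ
-- (repetitions and omissions allowed); there are finitely many premises.

record AnalyticRule : Set where
  field
    arity    : ℕ
    premises : List (List (Fin arity))

open AnalyticRule public

Υ : (r : AnalyticRule) → List (Fin (arity r))
Υ r = allFinL (arity r)

RuleSet : Set₁
RuleSet = AnalyticRule → Set

inst : ∀ {k} → (Fin k → List Formula) → List (Fin k) → List Formula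
inst σ = concatMap σ

infix 4 _⊢_
data _⊢_ (ℛ : RuleSet) : Sequent → Set where
  ax    : ∀ {p} → ℛ ⊢ (var p ∷ []) ⇒ var p
  rule  : ∀ {r Γ Δ β} → ℛ r → (σ : Fin (arity r) → List Formula) →
          All (λ Υᵢ → ℛ ⊢ (Γ ++ inst σ Υᵢ ++ Δ) ⇒ β) (premises r) →
          ℛ ⊢ (Γ ++ inst σ (Υ r) ++ Δ) ⇒ β
  0L    : ∀ {Γ Δ β} → ℛ ⊢ (Γ ++ 𝟘 ∷ Δ) ⇒ β
  1L    : ∀ {Γ Δ β} → ℛ ⊢ (Γ ++ Δ) ⇒ β → ℛ ⊢ (Γ ++ 𝟙 ∷ Δ) ⇒ β
  1R    : ℛ ⊢ [] ⇒ 𝟙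
  ∧L₁   : ∀ {Γ Δ α₁ α₂ β} → ℛ ⊢ (Γ ++ α₁ ∷ Δ) ⇒ β → ℛ ⊢ (Γ ++ (α₁ ∧ α₂) ∷ Δ) ⇒ β
  ∧L₂   : ∀ {Γ Δ α₁ α₂ β} → ℛ ⊢ (Γ ++ α₂ ∷ Δ) ⇒ β → ℛ ⊢ (Γ ++ (α₁ ∧ α₂) ∷ Δ) ⇒ β
  ∧R    : ∀ {Γ β₁ β₂} → ℛ ⊢ Γ ⇒ β₁ → ℛ ⊢ Γ ⇒ β₂ → ℛ ⊢ Γ ⇒ (β₁ ∧ β₂)
  ∨L    : ∀ {Γ Δ α₁ α₂ β} → ℛ ⊢ (Γ ++ α₁ ∷ Δ) ⇒ β → ℛ ⊢ (Γ ++ α₂ ∷ Δ) ⇒ β →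
          ℛ ⊢ (Γ ++ (α₁ ∨ α₂) ∷ Δ) ⇒ β
  ∨R₁   : ∀ {Γ β₁ β₂} → ℛ ⊢ Γ ⇒ β₁ → ℛ ⊢ Γ ⇒ (β₁ ∨ β₂)
  ∨R₂   : ∀ {Γ β₁ β₂} → ℛ ⊢ Γ ⇒ β₂ → ℛ ⊢ Γ ⇒ (β₁ ∨ β₂)
  ·L    : ∀ {Γ Δ α₁ α₂ β} → ℛ ⊢ (Γ ++ α₁ ∷ α₂ ∷ Δ) ⇒ β → ℛ ⊢ (Γ ++ (α₁ · α₂) ∷ Δ) ⇒ β
  ·R    : ∀ {Γ Δ β₁ β₂} → ℛ ⊢ Γ ⇒ β₁ → ℛ ⊢ Δ ⇒ β₂ → ℛ ⊢ (Γ ++ Δ) ⇒ (β₁ · β₂)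
  ⧵L    : ∀ {Γ Π Δ α γ β} → ℛ ⊢ Π ⇒ α → ℛ ⊢ (Γ ++ γ ∷ Δ) ⇒ β →
          ℛ ⊢ (Γ ++ Π ++ (α ⧵ γ) ∷ Δ) ⇒ β
  ⧵R    : ∀ {Γ α β} → ℛ ⊢ (α ∷ Γ) ⇒ β → ℛ ⊢ Γ ⇒ (α ⧵ β)
  /L    : ∀ {Γ Π Δ α γ β} → ℛ ⊢ Π ⇒ α → ℛ ⊢ (Γ ++ γ ∷ Δ) ⇒ β →
          ℛ ⊢ (Γ ++ (γ / α) ∷ Π ++ Δ) ⇒ β
  /R    : ∀ {Γ α β} → ℛ ⊢ (Γ ++ α ∷ []) ⇒ β → ℛ ⊢ Γ ⇒ (β / α)
  ⋆R₀   : ∀ {β} → ℛ ⊢ [] ⇒ (β ⋆)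
  ⋆R    : ∀ {Γ Δ β} → ℛ ⊢ Γ ⇒ β → ℛ ⊢ Δ ⇒ (β ⋆) → ℛ ⊢ (Γ ++ Δ) ⇒ (β ⋆)
  ω     : ∀ {Γ Δ α β} → ((n : ℕ) → ℛ ⊢ (Γ ++ replicate n α ++ Δ) ⇒ β) →
          ℛ ⊢ (Γ ++ (α ⋆) ∷ Δ) ⇒ β

power : ∀ {c} {A : Set c} → (A → A → A) → A → A → ℕ → A
power _∙_ e a zero    = e
power _∙_ e a (suc n) = a ∙ power _∙_ e a n

record StarContActionLattice (c ℓ : Level) : Set (lsuc (c ⊔ ℓ)) where
  infix  4 _≈_ _≤_
  field
    Carrier : Set c
    _≈_     : Carrier → Carrier → Set ℓ
    _≤_     : Carrier → Carrier → Set ℓ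
    isPartialOrder : IsPartialOrder _≈_ _≤_
    _⊓_ _⊔'_ _∙_ _↘_ _↙_ : Carrier → Carrier → Carrier
    _✶      : Carrier → Carrier
    ⊥' ε    : Carrier
    ⊓-lb₁   : ∀ x y → (x ⊓ y) ≤ x
    ⊓-lb₂   : ∀ x y → (x ⊓ y) ≤ y
    ⊓-glb   : ∀ x y z → z ≤ x → z ≤ y → z ≤ (x ⊓ y)
    ⊔-ub₁   : ∀ x y → x ≤ (x ⊔' y)
    ⊔-ub₂   : ∀ x y → y ≤ (x ⊔' y)
    ⊔-lub   : ∀ x y z → x ≤ z → y ≤ z → (x ⊔' y) ≤ z
    ⊥-least : ∀ x → ⊥' ≤ x
    ∙-assoc     : ∀ x y z → ((x ∙ y) ∙ z) ≈ (x ∙ (y ∙ z))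
    ∙-identityˡ : ∀ x → (ε ∙ x) ≈ x
    ∙-identityʳ : ∀ x → (x ∙ ε) ≈ x
    ↘-resid₁ : ∀ x y z → (x ∙ y) ≤ z → y ≤ (x ↘ z)
    ↘-resid₂ : ∀ x y z → y ≤ (x ↘ z) → (x ∙ y) ≤ z
    ↙-resid₁ : ∀ x y z → (x ∙ y) ≤ z → x ≤ (z ↙ y)
    ↙-resid₂ : ∀ x y z → x ≤ (z ↙ y) → (x ∙ y) ≤ z
    ✶-unfold : ∀ x → (ε ⊔' (x ∙ (x ✶))) ≤ (x ✶)
    ✶-indˡ   : ∀ x y → (x ∙ y) ≤ y → ((x ✶) ∙ y) ≤ y
    ✶-indʳ   : ∀ x y → (y ∙ x) ≤ y → (y ∙ (x ✶)) ≤ y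
    ✶-ub     : ∀ a n → power _∙_ ε a n ≤ (a ✶)
    ✶-lub    : ∀ a b → (∀ n → power _∙_ ε a n ≤ b) → (a ✶) ≤ b

module _ {c ℓ} (A : StarContActionLattice c ℓ) where
  open StarContActionLattice A

  prod : List Carrier → Carrier
  prod []           = ε
  prod (x ∷ [])     = x
  prod (x ∷ y ∷ xs) = x ∙ prod (y ∷ xs)

  ⟦_⟧ : Formula → (ℕ → Carrier) → Carrier
  ⟦ var p   ⟧ v = v p
  ⟦ α ∧ β   ⟧ v = ⟦ α ⟧ v ⊓ ⟦ β ⟧ v
  ⟦ α ∨ β   ⟧ v = ⟦ α ⟧ v ⊔' ⟦ β ⟧ v
  ⟦ α · β   ⟧ v = ⟦ α ⟧ v ∙ ⟦ β ⟧ v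
  ⟦ α ⧵ β   ⟧ v = ⟦ α ⟧ v ↘ ⟦ β ⟧ v
  ⟦ α / β   ⟧ v = ⟦ α ⟧ v ↙ ⟦ β ⟧ v
  ⟦ α ⋆     ⟧ v = (⟦ α ⟧ v) ✶
  ⟦ 𝟘       ⟧ v = ⊥'
  ⟦ 𝟙       ⟧ v = ε

  SatisfiesSequent : Sequent → Set (c ⊔ ℓ)
  SatisfiesSequent (Γ ⇒ β) = ∀ (v : ℕ → Carrier) → prod (map (λ α → ⟦ α ⟧ v) Γ) ≤ ⟦ β ⟧ v

  SatisfiesRuleQE : AnalyticRule → Set (c ⊔ ℓ)
  SatisfiesRuleQE r = ∀ (x : Fin (arity r) → Carrier) (y : Carrier) →
    All (λ Υᵢ → prod (map x Υᵢ) ≤ y) (premises r) → prod (map x (Υ r)) ≤ y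

  SatisfiesQa : RuleSet → Set (c ⊔ ℓ)
  SatisfiesQa ℛ = ∀ r → ℛ r → SatisfiesRuleQE r

module Submission where

open import Defs
open import Level using () renaming (suc to lsuc; zero to lzero)
open import Data.Nat using (ℕ; zero; suc)
open import Data.Fin using (Fin) renaming (zero to fzero; suc to fsuc)
open import Data.List using (List; []; _∷_; [_]; _++_; map; concatMap; concat; replicate; tabulate)
open import Data.List.Properties using (++-assoc; ++-identityʳ; concatMap-pure; map-tabulate)
open import Data.List.Relation.Unary.All as All using (All)
open import Data.Product using (Σ; _×_; _,_; proj₁; proj₂)
open import Data.Sum using (_⊎_; inj₁; inj₂)
open import Data.Empty using (⊥)
open import Relation.Binary.PropositionalEquality using (_≡_; refl; sym; trans; cong; subst)
open import Relation.Binary.Structures using (IsPartialOrder)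
open import Function using (id; _∘_)

-- Completeness via a syntactic model (a phase-semantics construction in the style of Okada).
-- Elements are sets X of antecedents, and Cl X consists of the antecedents Π that may stand in
-- for all of X at once: whenever Γ,S,Δ ⇒ β is derivable for every S ∈ X, so is Γ,Π,Δ ⇒ β.
-- Ordering X ≤ Y by X ⊆ Cl Y and taking X* to be the union of the powers of X gives a
-- *-continuous action lattice, and the rules of ℛ make it satisfy Q_a(ℛ). Interpreting each
-- variable p by the antecedents deriving p, every formula α satisfies α ∈ Cl ⟦α⟧ (the ω-rule
-- handles α*) and ⟦α⟧ ⊆ {Π | Π ⇒ α}.
-- Validity of α₀⋯αₙ ≤ β in this model then yields a derivation of α₀,…,αₙ ⇒ β.

module SyntacticModel (ℛ : RuleSet) where

  Pred : Set₁
  Pred = List Formula → Set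

  Derivable : Formula → Pred
  Derivable β Π = ℛ ⊢ Π ⇒ β

  ⊢-cast : ∀ {Γ Γ′ β} → Γ ≡ Γ′ → ℛ ⊢ Γ ⇒ β → ℛ ⊢ Γ′ ⇒ β
  ⊢-cast {β = β} = subst (λ Γ → ℛ ⊢ Γ ⇒ β)

  Cl : Pred → Pred
  Cl X Π = ∀ Γ Δ β → (∀ S → X S → ℛ ⊢ (Γ ++ S ++ Δ) ⇒ β) → ℛ ⊢ (Γ ++ Π ++ Δ) ⇒ β

  infix 4 _⊑_ _≋_

  _⊑_ : Pred → Pred → Set
  X ⊑ Y = ∀ Π → X Π → Cl Y Π

  _≋_ : Pred → Pred → Set
  X ≋ Y = X ⊑ Y × Y ⊑ X

  Cl-extensive : ∀ {X Π} → X Π → Cl X Π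
  Cl-extensive x Γ Δ β h = h _ x

  Cl-mono : ∀ {X Y Π} → X ⊑ Y → Cl X Π → Cl Y Π
  Cl-mono X⊑Y c Γ Δ β h = c Γ Δ β (λ S x → X⊑Y S x Γ Δ β h)

  ⊑-trans : ∀ {X Y Z} → X ⊑ Y → Y ⊑ Z → X ⊑ Z
  ⊑-trans X⊑Y Y⊑Z Π x = Cl-mono Y⊑Z (X⊑Y Π x)

  Cl-Derivable : ∀ {β Π} → Cl (Derivable β) Π → ℛ ⊢ Π ⇒ β
  Cl-Derivable {β} {Π} c =
    ⊢-cast (++-identityʳ Π) (c [] [] β (λ S d → ⊢-cast (sym (++-identityʳ S)) d))

  infixr 30 _∙ₘ_

  _⊓ₘ_ _⊔ₘ_ _∙ₘ_ _↘ₘ_ _↙ₘ_ : Pred → Pred → Pred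
  (X ⊓ₘ Y) Π = Cl X Π × Cl Y Π
  (X ⊔ₘ Y) Π = X Π ⊎ Y Π
  (X ∙ₘ Y) Π = Σ (List Formula) λ S₁ → Σ (List Formula) λ S₂ → Π ≡ S₁ ++ S₂ × X S₁ × Y S₂
  (X ↘ₘ Z) Π = ∀ S → Cl X S → Cl Z (S ++ Π)
  (Z ↙ₘ Y) Π = ∀ S → Cl Y S → Cl Z (Π ++ S)

  ⊥ₘ εₘ : Pred
  ⊥ₘ _ = ⊥
  εₘ Π = Π ≡ []

  powerₘ : Pred → ℕ → Pred
  powerₘ = power _∙ₘ_ εₘ

  starₘ : Pred → Pred
  starₘ X Π = Σ ℕ λ n → powerₘ X n Π

  Cl-∙ₘ : ∀ {X Y P₁ P₂} → Cl X P₁ → Cl Y P₂ → Cl (X ∙ₘ Y) (P₁ ++ P₂)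
  Cl-∙ₘ {P₁ = P₁} {P₂} c₁ c₂ Γ Δ β h =
    ⊢-cast (cong (Γ ++_) (sym (++-assoc P₁ P₂ Δ))) (c₁ Γ (P₂ ++ Δ) β λ S₁ x →
      ⊢-cast (++-assoc Γ S₁ (P₂ ++ Δ)) (c₂ (Γ ++ S₁) Δ β λ S₂ y →
        ⊢-cast (trans (cong (Γ ++_) (++-assoc S₁ S₂ Δ)) (sym (++-assoc Γ S₁ (S₂ ++ Δ))))
          (h (S₁ ++ S₂) (S₁ , S₂ , refl , x , y))))

  ⊑-isPartialOrder : IsPartialOrder _≋_ _⊑_
  ⊑-isPartialOrder = record
    { isPreorder = record
      { isEquivalence = record
        { refl  = (λ _ → Cl-extensive) , (λ _ → Cl-extensive)
        ; sym   = λ (X⊑Y , Y⊑X) → Y⊑X , X⊑Y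
        ; trans = λ (X⊑Y , Y⊑X) (Y⊑Z , Z⊑Y) → ⊑-trans X⊑Y Y⊑Z , ⊑-trans Z⊑Y Y⊑X
        }
      ; reflexive = proj₁
      ; trans     = ⊑-trans
      }
    ; antisym = _,_
    }

  ⊔ₘ-lub : ∀ X Y Z → X ⊑ Z → Y ⊑ Z → X ⊔ₘ Y ⊑ Z
  ⊔ₘ-lub X Y Z X⊑Z Y⊑Z Π (inj₁ x) = X⊑Z Π x
  ⊔ₘ-lub X Y Z X⊑Z Y⊑Z Π (inj₂ y) = Y⊑Z Π y

  ∙ₘ-assoc : ∀ X Y Z → (X ∙ₘ Y) ∙ₘ Z ≋ X ∙ₘ (Y ∙ₘ Z)
  ∙ₘ-assoc X Y Z = assocʳ , assocˡ
    where
    assocʳ : (X ∙ₘ Y) ∙ₘ Z ⊑ X ∙ₘ (Y ∙ₘ Z)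
    assocʳ _ (_ , S₃ , refl , (S₁ , S₂ , refl , x , y) , z) =
      Cl-extensive (S₁ , S₂ ++ S₃ , ++-assoc S₁ S₂ S₃ , x , S₂ , S₃ , refl , y , z)
    assocˡ : X ∙ₘ (Y ∙ₘ Z) ⊑ (X ∙ₘ Y) ∙ₘ Z
    assocˡ _ (S₁ , _ , refl , x , S₂ , S₃ , refl , y , z) =
      Cl-extensive (S₁ ++ S₂ , S₃ , sym (++-assoc S₁ S₂ S₃) , (S₁ , S₂ , refl , x , y) , z)

  ∙ₘ-identityˡ : ∀ X → εₘ ∙ₘ X ≋ X
  ∙ₘ-identityˡ X = (λ { _ (_ , _ , refl , refl , x) → Cl-extensive x })
                 , (λ Π x → Cl-extensive ([] , Π , refl , refl , x))

  ∙ₘ-identityʳ : ∀ X → X ∙ₘ εₘ ≋ X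
  ∙ₘ-identityʳ X = (λ { _ (S , _ , refl , x , refl) → Cl-extensive (subst X (sym (++-identityʳ S)) x) })
                 , (λ Π x → Cl-extensive (Π , [] , sym (++-identityʳ Π) , x , refl))

  ↘ₘ-resid₁ : ∀ X Y Z → X ∙ₘ Y ⊑ Z → Y ⊑ X ↘ₘ Z
  ↘ₘ-resid₁ X Y Z XY⊑Z Π y = Cl-extensive λ S x → Cl-mono XY⊑Z (Cl-∙ₘ x (Cl-extensive y))

  ↘ₘ-resid₂ : ∀ X Y Z → Y ⊑ X ↘ₘ Z → X ∙ₘ Y ⊑ Z
  ↘ₘ-resid₂ X Y Z Y⊑X↘Z _ (S₁ , S₂ , refl , x , y) =
    Cl-mono modusPonens (Cl-∙ₘ (Cl-extensive x) (Y⊑X↘Z S₂ y))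
    where
    modusPonens : X ∙ₘ (X ↘ₘ Z) ⊑ Z
    modusPonens _ (T₁ , T₂ , refl , x′ , f) = f T₁ (Cl-extensive x′)

  ↙ₘ-resid₁ : ∀ X Y Z → X ∙ₘ Y ⊑ Z → X ⊑ Z ↙ₘ Y
  ↙ₘ-resid₁ X Y Z XY⊑Z Π x = Cl-extensive λ S y → Cl-mono XY⊑Z (Cl-∙ₘ (Cl-extensive x) y)

  ↙ₘ-resid₂ : ∀ X Y Z → X ⊑ Z ↙ₘ Y → X ∙ₘ Y ⊑ Z
  ↙ₘ-resid₂ X Y Z X⊑Z↙Y _ (S₁ , S₂ , refl , x , y) =
    Cl-mono modusPonens (Cl-∙ₘ (X⊑Z↙Y S₁ x) (Cl-extensive y))
    where
    modusPonens : (Z ↙ₘ Y) ∙ₘ Y ⊑ Z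
    modusPonens _ (T₁ , T₂ , refl , f , y′) = f T₂ (Cl-extensive y′)

  starₘ-unfold : ∀ X → εₘ ⊔ₘ X ∙ₘ starₘ X ⊑ starₘ X
  starₘ-unfold X Π (inj₁ e)                           = Cl-extensive (zero , e)
  starₘ-unfold X Π (inj₂ (S₁ , S₂ , e , x , n , xⁿ)) = Cl-extensive (suc n , S₁ , S₂ , e , x , xⁿ)

  powerₘ-indˡ : ∀ X Y → X ∙ₘ Y ⊑ Y → ∀ n {S₁ S₂} → powerₘ X n S₁ → Cl Y S₂ → Cl Y (S₁ ++ S₂)
  powerₘ-indˡ X Y XY⊑Y zero    refl c = c
  powerₘ-indˡ X Y XY⊑Y (suc n) {S₂ = S₂} (T₁ , T₂ , refl , x , xⁿ) c =
    subst (Cl Y) (sym (++-assoc T₁ T₂ S₂))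
      (Cl-mono XY⊑Y (Cl-∙ₘ (Cl-extensive x) (powerₘ-indˡ X Y XY⊑Y n xⁿ c)))

  powerₘ-indʳ : ∀ X Y → Y ∙ₘ X ⊑ Y → ∀ n {S₁ S₂} → Cl Y S₁ → powerₘ X n S₂ → Cl Y (S₁ ++ S₂)
  powerₘ-indʳ X Y YX⊑Y zero    {S₁} c refl = subst (Cl Y) (sym (++-identityʳ S₁)) c
  powerₘ-indʳ X Y YX⊑Y (suc n) {S₁} c (T₁ , T₂ , refl , x , xⁿ) =
    subst (Cl Y) (++-assoc S₁ T₁ T₂)
      (powerₘ-indʳ X Y YX⊑Y n (Cl-mono YX⊑Y (Cl-∙ₘ c (Cl-extensive x))) xⁿ)

  𝕄 : StarContActionLattice (lsuc lzero) lzero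
  𝕄 = record
    { Carrier        = Pred
    ; _≈_            = _≋_
    ; _≤_            = _⊑_
    ; isPartialOrder = ⊑-isPartialOrder
    ; _⊓_ = _⊓ₘ_ ; _⊔'_ = _⊔ₘ_ ; _∙_ = _∙ₘ_ ; _↘_ = _↘ₘ_ ; _↙_ = _↙ₘ_
    ; _✶ = starₘ ; ⊥' = ⊥ₘ ; ε = εₘ
    ; ⊓-lb₁       = λ X Y Π → proj₁
    ; ⊓-lb₂       = λ X Y Π → proj₂
    ; ⊓-glb       = λ X Y Z Z⊑X Z⊑Y Π z → Cl-extensive (Z⊑X Π z , Z⊑Y Π z)
    ; ⊔-ub₁       = λ X Y Π x → Cl-extensive (inj₁ x)
    ; ⊔-ub₂       = λ X Y Π y → Cl-extensive (inj₂ y)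
    ; ⊔-lub       = ⊔ₘ-lub
    ; ⊥-least     = λ X Π ()
    ; ∙-assoc     = ∙ₘ-assoc
    ; ∙-identityˡ = ∙ₘ-identityˡ
    ; ∙-identityʳ = ∙ₘ-identityʳ
    ; ↘-resid₁    = ↘ₘ-resid₁
    ; ↘-resid₂    = ↘ₘ-resid₂
    ; ↙-resid₁    = ↙ₘ-resid₁
    ; ↙-resid₂    = ↙ₘ-resid₂
    ; ✶-unfold    = starₘ-unfold
    ; ✶-indˡ      = λ { X Y XY⊑Y _ (S₁ , S₂ , refl , (n , xⁿ) , y) →
                          powerₘ-indˡ X Y XY⊑Y n xⁿ (Cl-extensive y) }
    ; ✶-indʳ      = λ { X Y YX⊑Y _ (S₁ , S₂ , refl , y , (n , xⁿ)) →
                          powerₘ-indʳ X Y YX⊑Y n (Cl-extensive y) xⁿ }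
    ; ✶-ub        = λ X n Π xⁿ → Cl-extensive (n , xⁿ)
    ; ✶-lub       = λ { X Y xⁿ⊑Y Π (n , xⁿ) → xⁿ⊑Y n Π xⁿ }
    }

  Cl-prod : ∀ {A : Set} (f : A → Pred) (s : A → List Formula) → (∀ a → Cl (f a) (s a)) →
            ∀ as → Cl (prod 𝕄 (map f as)) (concatMap s as)
  Cl-prod f s c []           = Cl-extensive refl
  Cl-prod f s c (a ∷ [])     = subst (Cl (f a)) (sym (++-identityʳ (s a))) (c a)
  Cl-prod f s c (a ∷ b ∷ as) = Cl-∙ₘ (c a) (Cl-prod f s c (b ∷ as))

  prod-tabulate-split : ∀ k (X : Fin k → Pred) {Π} → prod 𝕄 (tabulate X) Π →
    Σ (Fin k → List Formula) λ τ → (∀ i → X i (τ i)) × Π ≡ concat (tabulate τ)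
  prod-tabulate-split zero          X refl = (λ ()) , (λ ()) , refl
  prod-tabulate-split (suc zero)    X {Π} x = (λ _ → Π) , (λ { fzero → x }) , sym (++-identityʳ Π)
  prod-tabulate-split (suc (suc k)) X (S₁ , S₂ , refl , x , xs)
    with τ , τ∈X , refl ← prod-tabulate-split (suc k) (X ∘ fsuc) xs =
    (λ { fzero → S₁ ; (fsuc i) → τ i }) , (λ { fzero → x ; (fsuc i) → τ∈X i }) , refl

  𝕄-satisfiesQa : SatisfiesQa 𝕄 ℛ
  𝕄-satisfiesQa r r∈ℛ X Y premises⊑Y Π Υ∈X
    with τ , τ∈X , refl ← prod-tabulate-split (arity r) X (subst (λ L → prod 𝕄 L Π) (map-tabulate id X) Υ∈X) =
    subst (Cl Y) (cong concat (map-tabulate id τ)) λ Γ Δ β h →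
      rule {Γ = Γ} {Δ} r∈ℛ τ
        (All.map (λ {Υᵢ} Υᵢ⊑Y → Cl-mono Υᵢ⊑Y (Cl-prod X τ (λ i → Cl-extensive (τ∈X i)) Υᵢ) Γ Δ β h) premises⊑Y)

  sem : Formula → Pred
  sem α = ⟦_⟧ 𝕄 α (Derivable ∘ var)

  powerₘ-replicate : ∀ {X α} → Cl X [ α ] → ∀ n → Cl (powerₘ X n) (replicate n α)
  powerₘ-replicate c zero    = Cl-extensive refl
  powerₘ-replicate c (suc n) = Cl-∙ₘ c (powerₘ-replicate c n)

  mutual
    formula∈Cl-sem : ∀ α → Cl (sem α) [ α ]
    formula∈Cl-sem (var p) = Cl-extensive ax
    formula∈Cl-sem (α ∧ β) =
      Cl-extensive ((λ Γ Δ γ h → ∧L₁ (formula∈Cl-sem α Γ Δ γ h)) , (λ Γ Δ γ h → ∧L₂ (formula∈Cl-sem β Γ Δ γ h)))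
    formula∈Cl-sem (α ∨ β) Γ Δ γ h =
      ∨L (formula∈Cl-sem α Γ Δ γ (λ S → h S ∘ inj₁)) (formula∈Cl-sem β Γ Δ γ (λ S → h S ∘ inj₂))
    formula∈Cl-sem (α · β) Γ Δ γ h = ·L (Cl-∙ₘ (formula∈Cl-sem α) (formula∈Cl-sem β) Γ Δ γ h)
    formula∈Cl-sem (α ⧵ β) = Cl-extensive λ S c Γ Δ γ h →
      ⊢-cast (cong (Γ ++_) (sym (++-assoc S [ α ⧵ β ] Δ)))
        (⧵L {Π = S} (Cl-sem⇒derivable α c) (formula∈Cl-sem β Γ Δ γ h))
    formula∈Cl-sem (β / α) = Cl-extensive λ S c Γ Δ γ h →
      /L {Π = S} (Cl-sem⇒derivable α c) (formula∈Cl-sem β Γ Δ γ h)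
    -- The ω-rule reduces α* to the sequences αⁿ, each lying in the closure of the n-th power.
    formula∈Cl-sem (α ⋆) Γ Δ γ h =
      ω λ n → Cl-mono (λ Π xⁿ → Cl-extensive (n , xⁿ)) (powerₘ-replicate (formula∈Cl-sem α) n) Γ Δ γ h
    formula∈Cl-sem 𝟘 Γ Δ γ h = 0L
    formula∈Cl-sem 𝟙 Γ Δ γ h = 1L (h [] refl)

    sem⊆derivable : ∀ α {Π} → sem α Π → ℛ ⊢ Π ⇒ α
    sem⊆derivable (var p) d                        = d
    sem⊆derivable (α ∧ β) (cα , cβ)                = ∧R (Cl-sem⇒derivable α cα) (Cl-sem⇒derivable β cβ)
    sem⊆derivable (α ∨ β) (inj₁ x)                 = ∨R₁ (sem⊆derivable α x)
    sem⊆derivable (α ∨ β) (inj₂ y)                 = ∨R₂ (sem⊆derivable β y)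
    sem⊆derivable (α · β) (S₁ , S₂ , refl , x , y) = ·R (sem⊆derivable α x) (sem⊆derivable β y)
    sem⊆derivable (α ⧵ β) f                        = ⧵R (Cl-sem⇒derivable β (f [ α ] (formula∈Cl-sem α)))
    sem⊆derivable (β / α) f                        = /R (Cl-sem⇒derivable β (f [ α ] (formula∈Cl-sem α)))
    sem⊆derivable (α ⋆) (n , xⁿ)                   = power⊆derivable n xⁿ
      where
      power⊆derivable : ∀ n {Π} → powerₘ (sem α) n Π → ℛ ⊢ Π ⇒ α ⋆
      power⊆derivable zero    refl                       = ⋆R₀
      power⊆derivable (suc n) (S₁ , S₂ , refl , x , xⁿ) = ⋆R (sem⊆derivable α x) (power⊆derivable n xⁿ)
    sem⊆derivable 𝟙 refl = 1R

    Cl-sem⇒derivable : ∀ α {Π} → Cl (sem α) Π → ℛ ⊢ Π ⇒ α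
    Cl-sem⇒derivable α c = Cl-Derivable (Cl-mono (λ Π x → Cl-extensive (sem⊆derivable α x)) c)

mainTheorem5 : (ℛ : RuleSet) (S : Sequent) →
    (∀ {c ℓ} (A : StarContActionLattice c ℓ) → SatisfiesQa A ℛ → SatisfiesSequent A S) →
    ℛ ⊢ S
mainTheorem5 ℛ (Γ ⇒ β) valid =
  ⊢-cast (concatMap-pure Γ)
    (Cl-sem⇒derivable β
      (Cl-mono (valid 𝕄 𝕄-satisfiesQa (Derivable ∘ var)) (Cl-prod sem [_] formula∈Cl-sem Γ)))
  where open SyntacticModel ℛ
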